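{- Let $m\geqslant 1$ and let $H$ be a Hadamard matrix of order $4m$. Fix three distinct rows $i,j,k$ of $H$, and for each integer $t$ with $0\leqslant t\leqslant \lfloor m/2\rfloor$ let $\kappa_t$ be the number of rows $\ell\notin\{i,j,k\}$ of $H$ with $T_{ijk\ell}=t$. Then $$\sum_{t=0}^{\lfloor m/2\rfloor}\kappa_t\,(m-2t)^2=m^2.$$
   Context: A Hadamard matrix of order $n$ is an $n\times n$ matrix $H=(h_{uv})$ with entries in $\{ -1,1\}$ such that $HH^\top=nI$. For four distinct rows $i,j,k,\ell$ of $H$, put $P_{ijk\ell}=\left|\sum_{r=1}^n h_{ir}h_{jr}h_{kr}h_{\ell r}\right|$; the type of the quadruple $\{i,j,k,\ell\}$ is $T_{ijk\ell}=\frac{n-P_{ijk\ell}}{8}$, which is an integer with $0\leqslant T_{ijk\ell}\leqslant\lfloor n/8\rfloor$. -}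

module Defs where

open import Data.Nat as ℕ using (ℕ; _∸_; _/_)
open import Data.Integer as ℤ using (ℤ; +_; -_; ∣_∣)
open import Data.Fin using (Fin)
open import Data.List using (List; foldr; map; filter; length; allFin)
open import Data.Product using (_×_)
open import Data.Sum using (_⊎_)
open import Relation.Binary.PropositionalEquality using (_≡_; _≢_)
open import Relation.Nullary using (Dec; ¬_)
open import Relation.Nullary.Decidable using (_×-dec_; ¬?)
import Data.Fin.Properties as FinP
open import Data.Sum.Base using ()

Σℤ : (n : ℕ) → (Fin n → ℤ) → ℤ
Σℤ n f = foldr ℤ._+_ (+ 0) (map f (allFin n))

IsHadamard : (n : ℕ) → (Fin n → Fin n → ℤ) → Set
IsHadamard n H =
  (∀ u v → H u v ≡ + 1 ⊎ H u v ≡ - (+ 1)) ×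
  ((∀ u → Σℤ n (λ r → H u r ℤ.* H u r) ≡ + n) ×
   (∀ u v → u ≢ v → Σℤ n (λ r → H u r ℤ.* H v r) ≡ + 0))

P : (n : ℕ) → (Fin n → Fin n → ℤ) → Fin n → Fin n → Fin n → Fin n → ℕ
P n H i j k l = ∣ Σℤ n (λ r → H i r ℤ.* H j r ℤ.* H k r ℤ.* H l r) ∣

-- T_{ijkl} = (n - P_{ijkl}) / 8  (an exact division for Hadamard matrices)
T : (n : ℕ) → (Fin n → Fin n → ℤ) → Fin n → Fin n → Fin n → Fin n → ℕ
T n H i j k l = (n ∸ P n H i j k l) / 8

κ : (n : ℕ) → (Fin n → Fin n → ℤ) → Fin n → Fin n → Fin n → ℕ → ℕ
κ n H i j k t =
  length (filter (λ l → ¬? (l FinP.≟ i) ×-dec ¬? (l FinP.≟ j) ×-dec ¬? (l FinP.≟ k)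
                         ×-dec (T n H i j k l ℕ.≟ t))
                 (allFin n))

module Submission where

-- Put x r = h_ir h_jr h_kr, so that the quadruple sums S_l = Σ_r x_r h_lr are the entries of H x.
-- Since HᵀH = nI as well as HHᵀ = nI, Parseval gives Σ_l S_l² = n Σ_r x_r² = n².  For l ∈ {i,j,k}
-- a row is repeated and S_l is an inner product of two distinct rows, hence 0.  Otherwise, for
-- ε = ±1, the sum over r of (1 + ε h_i h_j)(1 + ε h_i h_k)(1 + ε h_i h_l) expands to n + ε S_l,
-- while each factor is 0 or 2; so n ± S_l are both multiples of 8, |S_l| = n - 8T = 4(m - 2T) and
-- S_l² = 16 (m - 2T)².  Grouping the rows l by their type T gives 16 Σ_t κ_t (m - 2t)² = n² = 16 m².

module FinSums where

  open import Defs using (Σℤ)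
  open import Data.Nat as ℕ using (ℕ; zero; suc)
  open import Data.Fin using (Fin; zero; suc; punchIn; punchOut)
  open import Data.Fin.Properties using (punchInᵢ≢i; punchIn-punchOut)
  open import Data.Integer using (ℤ; +_; -[1+_]; ∣_∣; +≤+; 0ℤ; 1ℤ; _+_; _*_; _≤_; nonNegative)
  open import Data.Integer.Properties
    using (+-*-semiring; +-0-abelianGroup; +-identityʳ; +-mono-≤; i≤i+j; ≤-refl; ≤-antisym; pos-*; i*j≡0⇒i≡0∨j≡0)
  open import Data.List using ([]; _∷_; foldr; map; tabulate; allFin)
  open import Data.List.Properties using (map-tabulate)
  open import Data.Nat.ListAction using (sum)
  open import Data.Sum using (inj₁; inj₂)
  open import Data.Vec.Functional using (removeAt)
  open import Function using (_∘_)
  open import Relation.Binary.PropositionalEquality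
  open import Algebra.Bundles using (AbelianGroup)
  open import Algebra.Properties.Group (AbelianGroup.group +-0-abelianGroup) using (∙-cancelˡ)
  open import Algebra.Properties.Semiring.Sum +-*-semiring public
    using (sum-syntax; sum-cong-≗; ∑-distrib-+; ∑-comm; *-distribˡ-sum; *-distribʳ-sum)
  open import Algebra.Properties.Semiring.Sum +-*-semiring
    using (sum-remove; sum-replicate-zero)
  open ≡-Reasoning

  Σℤ≡∑ : ∀ n (f : Fin n → ℤ) → Σℤ n f ≡ ∑[ r < n ] f r
  Σℤ≡∑ n f = trans (cong (foldr _+_ 0ℤ) (map-tabulate (λ r → r) f)) (foldr-tabulate n f)
    where
    foldr-tabulate : ∀ n (f : Fin n → ℤ) → foldr _+_ 0ℤ (tabulate f) ≡ ∑[ r < n ] f r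
    foldr-tabulate zero    f = refl
    foldr-tabulate (suc n) f = cong (_+_ (f zero)) (foldr-tabulate n (f ∘ suc))

  ∑-ones : ∀ n → ∑[ r < n ] 1ℤ ≡ + n
  ∑-ones zero    = refl
  ∑-ones (suc n) = cong (_+_ 1ℤ) (∑-ones n)

  ∑-pos : ∀ n (f : Fin n → ℕ) → ∑[ r < n ] (+ f r) ≡ + sum (map f (allFin n))
  ∑-pos n f = trans (sym (Σℤ≡∑ n (+_ ∘ f))) (foldr-pos (allFin n))
    where
    foldr-pos : ∀ xs → foldr _+_ 0ℤ (map (+_ ∘ f) xs) ≡ + sum (map f xs)
    foldr-pos []       = refl
    foldr-pos (x ∷ xs) = cong (_+_ (+ f x)) (foldr-pos xs)

  ∑-*-∑ : ∀ {m n} (f : Fin m → ℤ) (g : Fin n → ℤ) →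
          (∑[ a < m ] f a) * (∑[ b < n ] g b) ≡ ∑[ a < m ] ∑[ b < n ] (f a * g b)
  ∑-*-∑ {m} {n} f g = trans (*-distribʳ-sum (∑[ b < n ] g b) f)
    (sum-cong-≗ (λ a → *-distribˡ-sum (f a) g))

  ∑-+-vanishing : ∀ {n} (f g : Fin n → ℤ) → ∑[ r < n ] g r ≡ 0ℤ → ∑[ r < n ] (f r + g r) ≡ ∑[ r < n ] f r
  ∑-+-vanishing {n} f g ∑g≡0 = begin
    ∑[ r < n ] (f r + g r)           ≡⟨ ∑-distrib-+ f g ⟩
    ∑[ r < n ] f r + ∑[ r < n ] g r  ≡⟨ cong (_+_ (∑[ r < n ] f r)) ∑g≡0 ⟩
    ∑[ r < n ] f r + 0ℤ              ≡⟨ +-identityʳ _ ⟩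
    ∑[ r < n ] f r                   ∎

  ∑-δ : ∀ {n} (f : Fin n → ℤ) a → (∀ b → b ≢ a → f b ≡ 0ℤ) → ∑[ r < n ] f r ≡ f a
  ∑-δ {suc n} f a vanish = begin
    ∑[ r < suc n ] f r                  ≡⟨ sum-remove {i = a} f ⟩
    f a + ∑[ r < n ] f (punchIn a r)   ≡⟨ cong (_+_ (f a)) (trans (sum-cong-≗ off-a) (sum-replicate-zero n)) ⟩
    f a + 0ℤ                            ≡⟨ +-identityʳ (f a) ⟩
    f a                                 ∎
    where
    off-a : ∀ r → f (punchIn a r) ≡ 0ℤ
    off-a r = vanish (punchIn a r) (punchInᵢ≢i a r)

  term-≤-∑ : ∀ {n} (f : Fin n → ℤ) → (∀ r → 0ℤ ≤ f r) → ∀ a → f a ≤ ∑[ r < n ] f r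
  term-≤-∑ {suc n} f nonneg a = subst (f a ≤_) (sym (sum-remove {i = a} f))
    (i≤i+j (f a) _ {{nonNegative (∑-nonneg (removeAt f a) (nonneg ∘ punchIn a))}})
    where
    ∑-nonneg : ∀ {n} (g : Fin n → ℤ) → (∀ r → 0ℤ ≤ g r) → 0ℤ ≤ ∑[ r < n ] g r
    ∑-nonneg {zero}  g _  = ≤-refl
    ∑-nonneg {suc n} g p = +-mono-≤ (p zero) (∑-nonneg (g ∘ suc) (p ∘ suc))

  nonneg-∑≡0 : ∀ {n} (f : Fin n → ℤ) → (∀ r → 0ℤ ≤ f r) → ∑[ r < n ] f r ≡ 0ℤ → ∀ a → f a ≡ 0ℤ
  nonneg-∑≡0 f nonneg ∑≡0 a = ≤-antisym (subst (f a ≤_) ∑≡0 (term-≤-∑ f nonneg a)) (nonneg a)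

  i*i≡∣i∣*∣i∣ : ∀ i → i * i ≡ + (∣ i ∣ ℕ.* ∣ i ∣)
  i*i≡∣i∣*∣i∣ (+ n)    = sym (pos-* n n)
  i*i≡∣i∣*∣i∣ -[1+ n ] = refl

  squares-concentrated : ∀ {n} (f : Fin n → ℤ) a →
                         ∑[ r < n ] (f r * f r) ≡ f a * f a → ∀ b → b ≢ a → f b ≡ 0ℤ
  squares-concentrated {suc n} f a ∑≡fa² b b≢a = i*i≡0⇒i≡0 (begin
    f b * f b                                ≡⟨ cong (λ c → f c * f c) (sym (punchIn-punchOut a≢b)) ⟩
    removeAt square a (punchOut a≢b)
      ≡⟨ nonneg-∑≡0 (removeAt square a) (square-nonneg ∘ f ∘ punchIn a) rest≡0 (punchOut a≢b) ⟩
    0ℤ                                       ∎)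
    where
    square : Fin (suc n) → ℤ
    square r = f r * f r
    a≢b = b≢a ∘ sym
    square-nonneg : ∀ i → 0ℤ ≤ i * i
    square-nonneg i = subst (0ℤ ≤_) (sym (i*i≡∣i∣*∣i∣ i)) (+≤+ ℕ.z≤n)
    rest≡0 : ∑[ r < n ] removeAt square a r ≡ 0ℤ
    rest≡0 = ∙-cancelˡ (square a) _ 0ℤ (trans (sym (sum-remove {i = a} square)) (trans ∑≡fa² (sym (+-identityʳ _))))
    i*i≡0⇒i≡0 : ∀ {i} → i * i ≡ 0ℤ → i ≡ 0ℤ
    i*i≡0⇒i≡0 {i} eq with i*j≡0⇒i≡0∨j≡0 i eq
    ... | inj₁ i≡0 = i≡0
    ... | inj₂ i≡0 = i≡0

module HadamardMatrices where

  open import Defs using (Σℤ; IsHadamard)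
  open import Data.Fin using (Fin)
  open import Data.Integer using (ℤ; +_; 0ℤ; 1ℤ; -1ℤ; _+_; _*_)
  open import Data.Integer.Properties using (*-comm; *-zeroʳ)
  open import Data.Integer.Tactic.RingSolver using (solve-∀)
  open import Data.Product using (_,_; proj₁; proj₂)
  open import Data.Sum using (_⊎_; inj₁; inj₂)
  open import Function using (_∘_)
  open import Relation.Binary.PropositionalEquality
  open FinSums
  open ≡-Reasoning

  IsSign : ℤ → Set
  IsSign x = x ≡ 1ℤ ⊎ x ≡ -1ℤ

  sign-square : ∀ {x} → IsSign x → x * x ≡ 1ℤ
  sign-square (inj₁ refl) = refl
  sign-square (inj₂ refl) = refl

  sign-* : ∀ {x y} → IsSign x → IsSign y → IsSign (x * y)
  sign-* (inj₁ refl) (inj₁ refl) = inj₁ refl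
  sign-* (inj₁ refl) (inj₂ refl) = inj₂ refl
  sign-* (inj₂ refl) (inj₁ refl) = inj₂ refl
  sign-* (inj₂ refl) (inj₂ refl) = inj₁ refl

  rows-orthogonal : ∀ {n} {H : Fin n → Fin n → ℤ} → IsHadamard n H →
                    ∀ {u v} → u ≢ v → ∑[ r < n ] (H u r * H v r) ≡ 0ℤ
  rows-orthogonal {n} {H} (_ , _ , orth) {u} {v} u≢v = trans (sym (Σℤ≡∑ n (λ r → H u r * H v r))) (orth u v u≢v)

  module _ {n} {H : Fin n → Fin n → ℤ}
           (norm : ∀ u → Σℤ n (λ r → H u r * H u r) ≡ + n)
           (orth : ∀ u v → u ≢ v → Σℤ n (λ r → H u r * H v r) ≡ 0ℤ) where

    inner : Fin n → Fin n → ℤ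
    inner u v = ∑[ s < n ] (H u s * H v s)

    gram : ∀ (x y : Fin n → ℤ) →
           ∑[ s < n ] ((∑[ u < n ] (x u * H u s)) * (∑[ v < n ] (y v * H v s))) ≡ + n * ∑[ u < n ] (x u * y u)
    gram x y = begin
      ∑[ s < n ] ((∑[ u < n ] (x u * H u s)) * (∑[ v < n ] (y v * H v s)))
        ≡⟨ sum-cong-≗ (λ s → ∑-*-∑ (λ u → x u * H u s) (λ v → y v * H v s)) ⟩
      ∑[ s < n ] ∑[ u < n ] ∑[ v < n ] (x u * H u s * (y v * H v s))
        ≡⟨ ∑-comm (λ s u → ∑[ v < n ] (x u * H u s * (y v * H v s))) ⟩
      ∑[ u < n ] ∑[ s < n ] ∑[ v < n ] (x u * H u s * (y v * H v s))
        ≡⟨ sum-cong-≗ (λ u → ∑-comm (λ s v → x u * H u s * (y v * H v s))) ⟩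
      ∑[ u < n ] ∑[ v < n ] ∑[ s < n ] (x u * H u s * (y v * H v s))
        ≡⟨ sum-cong-≗ (λ u → sum-cong-≗ (λ v → factor-inner u v)) ⟩
      ∑[ u < n ] ∑[ v < n ] (x u * y v * inner u v)
        ≡⟨ sum-cong-≗ (λ u → ∑-δ (λ v → x u * y v * inner u v) u (λ v v≢u → off-diagonal u v (v≢u ∘ sym))) ⟩
      ∑[ u < n ] (x u * y u * inner u u)
        ≡⟨ sum-cong-≗ (λ u → cong (x u * y u *_) (trans (sym (Σℤ≡∑ n (λ s → H u s * H u s))) (norm u))) ⟩
      ∑[ u < n ] (x u * y u * + n)
        ≡⟨ sym (*-distribʳ-sum (+ n) (λ u → x u * y u)) ⟩
      (∑[ u < n ] (x u * y u)) * + n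
        ≡⟨ *-comm _ (+ n) ⟩
      + n * ∑[ u < n ] (x u * y u) ∎
      where
      factor-inner : ∀ u v → ∑[ s < n ] (x u * H u s * (y v * H v s)) ≡ x u * y v * inner u v
      factor-inner u v = trans
        (sum-cong-≗ (λ s → interchange (x u) (H u s) (y v) (H v s)))
        (sym (*-distribˡ-sum (x u * y v) (λ s → H u s * H v s)))
        where
        interchange : ∀ a b c d → a * b * (c * d) ≡ a * c * (b * d)
        interchange = solve-∀
      off-diagonal : ∀ u v → u ≢ v → x u * y v * inner u v ≡ 0ℤ
      off-diagonal u v u≢v = trans (cong (x u * y v *_) (trans (sym (Σℤ≡∑ n (λ s → H u s * H v s))) (orth u v u≢v)))
                                   (*-zeroʳ (x u * y v))

  -- The column inner products c u s satisfy Σ_s (c u s)² = n² = (c u u)² by gram, forcing c u s = 0 for s ≠ u.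
  transpose-isHadamard : ∀ {n} {H : Fin n → Fin n → ℤ} → IsHadamard n H → IsHadamard n (λ u v → H v u)
  transpose-isHadamard {n} {H} (sign , norm , orth) = (λ u v → sign v u) , column-norm , column-orth
    where
    column-norm : ∀ u → Σℤ n (λ r → H r u * H r u) ≡ + n
    column-norm u = trans (Σℤ≡∑ n _) (trans (sum-cong-≗ (λ r → sign-square (sign r u))) (∑-ones n))
    column : Fin n → Fin n → ℤ
    column u s = ∑[ r < n ] (H r u * H r s)
    column-concentrated : ∀ u → ∑[ s < n ] (column u s * column u s) ≡ column u u * column u u
    column-concentrated u = begin
      ∑[ s < n ] (column u s * column u s)  ≡⟨ gram norm orth (λ r → H r u) (λ r → H r u) ⟩
      + n * column u u                      ≡⟨ cong (_* column u u) (sym column-norm′) ⟩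
      column u u * column u u               ∎
      where
      column-norm′ : column u u ≡ + n
      column-norm′ = trans (sym (Σℤ≡∑ n _)) (column-norm u)
    column-orth : ∀ u v → u ≢ v → Σℤ n (λ r → H r u * H r v) ≡ 0ℤ
    column-orth u v u≢v = trans (Σℤ≡∑ n _) (squares-concentrated (column u) u (column-concentrated u) v (u≢v ∘ sym))

  parseval : ∀ {n} {H : Fin n → Fin n → ℤ} → IsHadamard n H → ∀ (x : Fin n → ℤ) →
             ∑[ l < n ] ((∑[ r < n ] (x r * H l r)) * (∑[ r < n ] (x r * H l r))) ≡ + n * ∑[ r < n ] (x r * x r)
  parseval hd x = gram (proj₁ (proj₂ hdᵀ)) (proj₂ (proj₂ hdᵀ)) x x
    where hdᵀ = transpose-isHadamard hd

module Quadruples where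

  open import Defs using (Σℤ; IsHadamard; P; T)
  open import Data.Nat as ℕ using (ℕ; _∸_; _/_)
  import Data.Nat.Properties as ℕ
  open import Data.Nat.DivMod using (m*n/n≡m)
  open import Data.Fin using (Fin)
  open import Data.Integer using (ℤ; +_; -_; -[1+_]; 0ℤ; 1ℤ; -1ℤ; ∣_∣; _+_; _*_)
  open import Data.Integer.Properties using (*-identityˡ; *-identityʳ; pos-*; +-injective)
  import Data.Integer.Tactic.RingSolver as ℤ-Solver
  import Data.Nat.Tactic.RingSolver as ℕ-Solver
  open import Data.List using ([]; _∷_; map; allFin)
  open import Data.Nat.ListAction using (sum)
  open import Data.Product using (∃; _,_; proj₁; proj₂)
  open import Data.Sum using (_⊎_; inj₁; inj₂)
  open import Function using (_∘_)
  open import Relation.Binary.PropositionalEquality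
  open FinSums
  open HadamardMatrices using (IsSign; sign-square; sign-*; rows-orthogonal; parseval)
  open ≡-Reasoning

  agreement-expansion : ∀ ε x y z w → ε * ε ≡ 1ℤ → x * x ≡ 1ℤ →
    (1ℤ + ε * x * y) * (1ℤ + ε * x * z) * (1ℤ + ε * x * w)
      ≡ 1ℤ + ε * (x * y * z * w + (x * y + x * z + x * w)) + (y * z + y * w + z * w)
  agreement-expansion ε x y z w ε²≡1 x²≡1 = begin
    (1ℤ + ε * x * y) * (1ℤ + ε * x * z) * (1ℤ + ε * x * w)
      ≡⟨ ℤ-Solver.solve (ε ∷ x ∷ y ∷ z ∷ w ∷ []) ⟩
    1ℤ + ε * (x * y * z * w * (ε * ε * (x * x)) + (x * y + x * z + x * w)) + (y * z + y * w + z * w) * (ε * ε * (x * x))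
      ≡⟨ cong (λ t → 1ℤ + ε * (x * y * z * w * t + (x * y + x * z + x * w)) + (y * z + y * w + z * w) * t)
              (cong₂ _*_ ε²≡1 x²≡1) ⟩
    1ℤ + ε * (x * y * z * w * 1ℤ + (x * y + x * z + x * w)) + (y * z + y * w + z * w) * 1ℤ
      ≡⟨ cong₂ (λ t u → 1ℤ + ε * (t + (x * y + x * z + x * w)) + u)
               (*-identityʳ (x * y * z * w)) (*-identityʳ (y * z + y * w + z * w)) ⟩
    1ℤ + ε * (x * y * z * w + (x * y + x * z + x * w)) + (y * z + y * w + z * w) ∎

  one-plus-sign : ∀ {s} → IsSign s → ∃ λ e → 1ℤ + s ≡ + (2 ℕ.* e)
  one-plus-sign (inj₁ refl) = 1 , refl
  one-plus-sign (inj₂ refl) = 0 , refl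

  agreement-divisible : ∀ {ε x y z w} → IsSign ε → IsSign x → IsSign y → IsSign z → IsSign w →
    ∃ λ e → (1ℤ + ε * x * y) * (1ℤ + ε * x * z) * (1ℤ + ε * x * w) ≡ + (8 ℕ.* e)
  agreement-divisible {ε} {x} {y} {z} {w} ε± x± y± z± w±
    with p , 1+εxy ← one-plus-sign (sign-* (sign-* ε± x±) y±)
       | q , 1+εxz ← one-plus-sign (sign-* (sign-* ε± x±) z±)
       | r , 1+εxw ← one-plus-sign (sign-* (sign-* ε± x±) w±)
    = p ℕ.* q ℕ.* r , (begin
      (1ℤ + ε * x * y) * (1ℤ + ε * x * z) * (1ℤ + ε * x * w)
        ≡⟨ cong₂ _*_ (cong₂ _*_ 1+εxy 1+εxz) 1+εxw ⟩
      + (2 ℕ.* p) * + (2 ℕ.* q) * + (2 ℕ.* r)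
        ≡⟨ cong (_* + (2 ℕ.* r)) (sym (pos-* (2 ℕ.* p) (2 ℕ.* q))) ⟩
      + (2 ℕ.* p ℕ.* (2 ℕ.* q)) * + (2 ℕ.* r)
        ≡⟨ sym (pos-* (2 ℕ.* p ℕ.* (2 ℕ.* q)) (2 ℕ.* r)) ⟩
      + (2 ℕ.* p ℕ.* (2 ℕ.* q) ℕ.* (2 ℕ.* r))
        ≡⟨ cong +_ (ℕ-Solver.solve (p ∷ q ∷ r ∷ [])) ⟩
      + (8 ℕ.* (p ℕ.* q ℕ.* r)) ∎)

  ∣s∣+8C≡n : ∀ n s → (∀ {ε} → IsSign ε → ∃ λ A → + n + ε * s ≡ + (8 ℕ.* A)) →
             ∃ λ C → ∣ s ∣ ℕ.+ 8 ℕ.* C ≡ n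
  ∣s∣+8C≡n n (+ p) n+εs with B , eq ← n+εs (inj₂ refl) =
    B , +-injective (trans (cong (_+_ (+ p)) (sym eq)) (cancel (+ n) (+ p)))
    where
    cancel : ∀ m t → t + (m + -1ℤ * t) ≡ m
    cancel = ℤ-Solver.solve-∀
  ∣s∣+8C≡n n -[1+ p ] n+εs with A , eq ← n+εs (inj₁ refl) =
    A , +-injective (trans (cong (_+_ (- -[1+ p ])) (sym eq)) (cancel (+ n) -[1+ p ]))
    where
    cancel : ∀ m t → - t + (m + 1ℤ * t) ≡ m
    cancel = ℤ-Solver.solve-∀

  p+8c≡n⇒p+8[n∸p]/8≡n : ∀ {n p c} → p ℕ.+ 8 ℕ.* c ≡ n → p ℕ.+ 8 ℕ.* ((n ∸ p) / 8) ≡ n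
  p+8c≡n⇒p+8[n∸p]/8≡n {n} {p} {c} refl = cong (λ t → p ℕ.+ 8 ℕ.* t) (begin
    (p ℕ.+ 8 ℕ.* c ∸ p) / 8  ≡⟨ cong (_/ 8) (ℕ.m+n∸m≡n p (8 ℕ.* c)) ⟩
    (8 ℕ.* c) / 8            ≡⟨ cong (_/ 8) (ℕ.*-comm 8 c) ⟩
    (c ℕ.* 8) / 8            ≡⟨ m*n/n≡m c 8 ⟩
    c                        ∎)

  module _ {n} {H : Fin n → Fin n → ℤ} (hd : IsHadamard n H) {a b c d : Fin n}
           (a≢b : a ≢ b) (a≢c : a ≢ c) (a≢d : a ≢ d) (b≢c : b ≢ c) (b≢d : b ≢ d) (c≢d : c ≢ d) where

    S : ℤ
    S = ∑[ r < n ] (H a r * H b r * H c r * H d r)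

    agreements : ℤ → Fin n → ℤ
    agreements ε r = (1ℤ + ε * H a r * H b r) * (1ℤ + ε * H a r * H c r) * (1ℤ + ε * H a r * H d r)

    ∑-agreements : ∀ {ε} → IsSign ε → ∑[ r < n ] agreements ε r ≡ + n + ε * S
    ∑-agreements {ε} ε± = begin
      ∑[ r < n ] agreements ε r
        ≡⟨ sum-cong-≗ (λ r → agreement-expansion ε (H a r) (H b r) (H c r) (H d r)
                                 (sign-square ε±) (sign-square (proj₁ hd a r))) ⟩
      ∑[ r < n ] (1ℤ + ε * (H a r * H b r * H c r * H d r + pairsᵃ r) + pairsᵇᶜᵈ r)
        ≡⟨ ∑-+-vanishing (λ r → 1ℤ + ε * (H a r * H b r * H c r * H d r + pairsᵃ r)) pairsᵇᶜᵈ
                         (∑-pairs≡0 b≢c b≢d c≢d) ⟩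
      ∑[ r < n ] (1ℤ + ε * (H a r * H b r * H c r * H d r + pairsᵃ r))
        ≡⟨ ∑-distrib-+ (λ _ → 1ℤ) (λ r → ε * (H a r * H b r * H c r * H d r + pairsᵃ r)) ⟩
      ∑[ r < n ] 1ℤ + ∑[ r < n ] (ε * (H a r * H b r * H c r * H d r + pairsᵃ r))
        ≡⟨ cong₂ _+_ (∑-ones n) (sym (*-distribˡ-sum ε (λ r → H a r * H b r * H c r * H d r + pairsᵃ r))) ⟩
      + n + ε * ∑[ r < n ] (H a r * H b r * H c r * H d r + pairsᵃ r)
        ≡⟨ cong (λ t → + n + ε * t) (∑-+-vanishing (λ r → H a r * H b r * H c r * H d r) pairsᵃ
                                                    (∑-pairs≡0 a≢b a≢c a≢d)) ⟩
      + n + ε * S ∎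
      where
      pairsᵃ pairsᵇᶜᵈ : Fin n → ℤ
      pairsᵃ r = H a r * H b r + H a r * H c r + H a r * H d r
      pairsᵇᶜᵈ r = H b r * H c r + H b r * H d r + H c r * H d r
      ∑-pairs≡0 : ∀ {u v w x y z} → u ≢ v → w ≢ x → y ≢ z →
                  ∑[ r < n ] (H u r * H v r + H w r * H x r + H y r * H z r) ≡ 0ℤ
      ∑-pairs≡0 {u} {v} {w} {x} {y} {z} u≢v w≢x y≢z =
        trans (∑-+-vanishing (λ r → H u r * H v r + H w r * H x r) (λ r → H y r * H z r) (rows-orthogonal hd y≢z))
        (trans (∑-+-vanishing (λ r → H u r * H v r) (λ r → H w r * H x r) (rows-orthogonal hd w≢x))
               (rows-orthogonal hd u≢v))

    n+εS-divisible : ∀ {ε} → IsSign ε → ∃ λ A → + n + ε * S ≡ + (8 ℕ.* A)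
    n+εS-divisible {ε} ε± = sum (map e (allFin n)) , (begin
      + n + ε * S                          ≡⟨ sym (∑-agreements ε±) ⟩
      ∑[ r < n ] agreements ε r            ≡⟨ sum-cong-≗ (proj₂ ∘ divisible) ⟩
      ∑[ r < n ] (+ (8 ℕ.* e r))           ≡⟨ sum-cong-≗ (λ r → pos-* 8 (e r)) ⟩
      ∑[ r < n ] (+ 8 * + e r)             ≡⟨ sym (*-distribˡ-sum (+ 8) (+_ ∘ e)) ⟩
      + 8 * ∑[ r < n ] (+ e r)             ≡⟨ cong (+ 8 *_) (∑-pos n e) ⟩
      + 8 * + sum (map e (allFin n))       ≡⟨ sym (pos-* 8 (sum (map e (allFin n)))) ⟩
      + (8 ℕ.* sum (map e (allFin n)))     ∎)
      where
      sign = proj₁ hd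
      divisible : ∀ r → ∃ λ e → agreements ε r ≡ + (8 ℕ.* e)
      divisible r = agreement-divisible ε± (sign a r) (sign b r) (sign c r) (sign d r)
      e : Fin n → ℕ
      e = proj₁ ∘ divisible

    P+8T≡n : P n H a b c d ℕ.+ 8 ℕ.* T n H a b c d ≡ n
    P+8T≡n = p+8c≡n⇒p+8[n∸p]/8≡n {p = P n H a b c d} {c = C}
      (trans (cong (λ t → ∣ t ∣ ℕ.+ 8 ℕ.* C) (Σℤ≡∑ n (λ r → H a r * H b r * H c r * H d r))) ∣S∣+8C≡n)
      where
      C = proj₁ (∣s∣+8C≡n n S n+εS-divisible)
      ∣S∣+8C≡n = proj₂ (∣s∣+8C≡n n S n+εS-divisible)

  sum-P²≡n² : ∀ {n} {H : Fin n → Fin n → ℤ} → IsHadamard n H → ∀ a b c →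
              sum (map (λ l → P n H a b c l ℕ.* P n H a b c l) (allFin n)) ≡ n ℕ.* n
  sum-P²≡n² {n} {H} hd a b c = +-injective (begin
    + sum (map (λ l → P n H a b c l ℕ.* P n H a b c l) (allFin n))
      ≡⟨ sym (∑-pos n (λ l → P n H a b c l ℕ.* P n H a b c l)) ⟩
    ∑[ l < n ] (+ (P n H a b c l ℕ.* P n H a b c l))
      ≡⟨ sum-cong-≗ (λ l → trans (sym (i*i≡∣i∣*∣i∣ (Σℤ n (λ r → x r * H l r))))
                                 (cong (λ s → s * s) (Σℤ≡∑ n (λ r → x r * H l r)))) ⟩
    ∑[ l < n ] ((∑[ r < n ] (x r * H l r)) * (∑[ r < n ] (x r * H l r)))
      ≡⟨ parseval hd x ⟩
    + n * ∑[ r < n ] (x r * x r)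
      ≡⟨ cong (+ n *_) (trans (sum-cong-≗ (λ r → sign-square (x± r))) (∑-ones n)) ⟩
    + n * + n
      ≡⟨ sym (pos-* n n) ⟩
    + (n ℕ.* n) ∎)
    where
    x : Fin n → ℤ
    x r = H a r * H b r * H c r
    x± : ∀ r → IsSign (x r)
    x± r = sign-* (sign-* (proj₁ hd a r) (proj₁ hd b r)) (proj₁ hd c r)

  P-repeated-row : ∀ {n} {H : Fin n → Fin n → ℤ} → IsHadamard n H → ∀ {a b c} → a ≢ b → a ≢ c → b ≢ c →
                   ∀ {l} → l ≡ a ⊎ l ≡ b ⊎ l ≡ c → P n H a b c l ≡ 0
  P-repeated-row {n} {H} hd {a} {b} {c} a≢b a≢c b≢c = λ where
      (inj₁ refl)        → square-factor a b≢c (λ r → reorder₁ (H a r) (H b r) (H c r))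
      (inj₂ (inj₁ refl)) → square-factor b a≢c (λ r → reorder₂ (H a r) (H b r) (H c r))
      (inj₂ (inj₂ refl)) → square-factor c a≢b (λ r → reorder₃ (H a r) (H b r) (H c r))
    where
    square-factor : ∀ {q : Fin n → ℤ} w {u v} → u ≢ v → (∀ r → q r ≡ H w r * H w r * (H u r * H v r)) →
                    ∣ Σℤ n q ∣ ≡ 0
    square-factor {q} w {u} {v} u≢v q≡ = cong ∣_∣ (begin
      Σℤ n q                                    ≡⟨ Σℤ≡∑ n q ⟩
      ∑[ r < n ] q r
        ≡⟨ sum-cong-≗ (λ r → trans (q≡ r) (cong (_* (H u r * H v r)) (sign-square (proj₁ hd w r)))) ⟩
      ∑[ r < n ] (1ℤ * (H u r * H v r))         ≡⟨ sum-cong-≗ (λ r → *-identityˡ (H u r * H v r)) ⟩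
      ∑[ r < n ] (H u r * H v r)                ≡⟨ rows-orthogonal hd u≢v ⟩
      0ℤ                                        ∎)
    reorder₁ : ∀ x y z → x * y * z * x ≡ x * x * (y * z)
    reorder₁ = ℤ-Solver.solve-∀
    reorder₂ : ∀ x y z → x * y * z * y ≡ y * y * (x * z)
    reorder₂ = ℤ-Solver.solve-∀
    reorder₃ : ∀ x y z → x * y * z * z ≡ z * z * (x * y)
    reorder₃ = ℤ-Solver.solve-∀

module Counting where

  open import Data.Nat using (ℕ; zero; suc; _+_; _*_; _<_; _≟_; s≤s)
  open import Data.Nat.Properties using (+-identityʳ; *-distribˡ-+; *-distribʳ-+; *-zeroʳ; suc-injective; +-commutativeSemigroup)
  open import Algebra.Properties.CommutativeSemigroup +-commutativeSemigroup using () renaming (interchange to +-interchange)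
  open import Data.Nat.ListAction using (sum)
  open import Data.Bool using (true; false; if_then_else_)
  open import Data.List using ([]; _∷_; map; filter; length; upTo; applyUpTo)
  open import Data.List.Properties using (map-cong; map-upTo)
  open import Function using (_∘_)
  open import Relation.Nullary using (Dec; does; yes; no; ¬_)
  open import Relation.Nullary.Decidable using (_×-dec_; dec-true; dec-false)
  open import Relation.Unary using (Pred; Decidable)
  open import Relation.Binary.PropositionalEquality
  open ≡-Reasoning

  indicator : ∀ {p} {P : Set p} → Dec P → ℕ
  indicator P? = if does P? then 1 else 0

  sum-map-zero : ∀ {a} {A : Set a} (f : A → ℕ) → (∀ x → f x ≡ 0) → ∀ xs → sum (map f xs) ≡ 0
  sum-map-zero f f≡0 []       = refl
  sum-map-zero f f≡0 (x ∷ xs) = cong₂ _+_ (f≡0 x) (sum-map-zero f f≡0 xs)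

  sum-map-+ : ∀ {a} {A : Set a} (f g : A → ℕ) xs → sum (map (λ x → f x + g x) xs) ≡ sum (map f xs) + sum (map g xs)
  sum-map-+ f g []       = refl
  sum-map-+ f g (x ∷ xs) = begin
    f x + g x + sum (map (λ x → f x + g x) xs)         ≡⟨ cong (f x + g x +_) (sum-map-+ f g xs) ⟩
    f x + g x + (sum (map f xs) + sum (map g xs))      ≡⟨ +-interchange (f x) (g x) _ _ ⟩
    f x + sum (map f xs) + (g x + sum (map g xs))      ∎

  sum-map-*ˡ : ∀ {a} {A : Set a} c (f : A → ℕ) xs → sum (map (λ x → c * f x) xs) ≡ c * sum (map f xs)
  sum-map-*ˡ c f []       = sym (*-zeroʳ c)
  sum-map-*ˡ c f (x ∷ xs) = trans (cong (c * f x +_) (sum-map-*ˡ c f xs)) (sym (*-distribˡ-+ c (f x) _))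

  sum-applyUpTo-δ : ∀ (h : ℕ → ℕ) {a} N → a < N → (∀ t → t ≢ a → h t ≡ 0) → sum (applyUpTo h N) ≡ h a
  sum-applyUpTo-δ h {zero} (suc N) _ vanish = begin
    h 0 + sum (applyUpTo (h ∘ suc) N)     ≡⟨ cong (λ xs → h 0 + sum xs) (sym (map-upTo (h ∘ suc) N)) ⟩
    h 0 + sum (map (h ∘ suc) (upTo N))
      ≡⟨ cong (h 0 +_) (sum-map-zero (h ∘ suc) (λ t → vanish (suc t) λ ()) (upTo N)) ⟩
    h 0 + 0                               ≡⟨ +-identityʳ (h 0) ⟩
    h 0                                   ∎
  sum-applyUpTo-δ h {suc a} (suc N) (s≤s a<N) vanish =
    cong₂ _+_ (vanish 0 λ ()) (sum-applyUpTo-δ (h ∘ suc) N a<N (λ t t≢a → vanish (suc t) (t≢a ∘ suc-injective)))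

  length-filter-∷ : ∀ {a p} {A : Set a} {P : Pred A p} (P? : Decidable P) x xs →
                    length (filter P? (x ∷ xs)) ≡ indicator (P? x) + length (filter P? xs)
  length-filter-∷ P? x xs with does (P? x)
  ... | true  = refl
  ... | false = refl

  sum-count : ∀ {a} {A : Set a} (τ : A → ℕ) (w : ℕ → ℕ) {N} → (∀ x → τ x < N) → ∀ xs →
              sum (map (λ t → length (filter (λ x → τ x ≟ t) xs) * w t) (upTo N)) ≡ sum (map (w ∘ τ) xs)
  sum-count τ w {N} τ<N []       = sum-map-zero (λ _ → 0) (λ _ → refl) (upTo N)
  sum-count τ w {N} τ<N (x ∷ xs) = begin
    sum (map (λ t → length (filter (λ x → τ x ≟ t) (x ∷ xs)) * w t) (upTo N))
      ≡⟨ cong sum (map-cong (λ t → trans (cong (_* w t) (length-filter-∷ (λ x → τ x ≟ t) x xs))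
                                         (*-distribʳ-+ (w t) (indicator (τ x ≟ t)) _)) (upTo N)) ⟩
    sum (map (λ t → indicator (τ x ≟ t) * w t + length (filter (λ x → τ x ≟ t) xs) * w t) (upTo N))
      ≡⟨ sum-map-+ (λ t → indicator (τ x ≟ t) * w t) (λ t → length (filter (λ x → τ x ≟ t) xs) * w t) (upTo N) ⟩
    sum (map (λ t → indicator (τ x ≟ t) * w t) (upTo N))
      + sum (map (λ t → length (filter (λ x → τ x ≟ t) xs) * w t) (upTo N))
      ≡⟨ cong₂ _+_ weight-of-x (sum-count τ w τ<N xs) ⟩
    w (τ x) + sum (map (w ∘ τ) xs) ∎
    where
    weight-of-x : sum (map (λ t → indicator (τ x ≟ t) * w t) (upTo N)) ≡ w (τ x)
    weight-of-x = begin
      sum (map (λ t → indicator (τ x ≟ t) * w t) (upTo N))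
        ≡⟨ cong sum (map-upTo (λ t → indicator (τ x ≟ t) * w t) N) ⟩
      sum (applyUpTo (λ t → indicator (τ x ≟ t) * w t) N)
        ≡⟨ sum-applyUpTo-δ (λ t → indicator (τ x ≟ t) * w t) N (τ<N x) off-τx ⟩
      indicator (τ x ≟ τ x) * w (τ x)
        ≡⟨ cong (λ b → (if b then 1 else 0) * w (τ x)) (dec-true (τ x ≟ τ x) refl) ⟩
      w (τ x) + 0
        ≡⟨ +-identityʳ (w (τ x)) ⟩
      w (τ x) ∎
      where
      off-τx : ∀ t → t ≢ τ x → indicator (τ x ≟ t) * w t ≡ 0
      off-τx t t≢τx = cong (λ b → (if b then 1 else 0) * w t) (dec-false (τ x ≟ t) (t≢τx ∘ sym))

  filter-×-dec : ∀ {a p q} {A : Set a} {P : Pred A p} {Q : Pred A q} (P? : Decidable P) (Q? : Decidable Q) xs →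
                 filter (λ x → P? x ×-dec Q? x) xs ≡ filter Q? (filter P? xs)
  filter-×-dec P? Q? []       = refl
  filter-×-dec P? Q? (x ∷ xs) with ih ← filter-×-dec P? Q? xs | does (P? x)
  ... | false = ih
  ... | true with does (Q? x)
  ...   | true  = cong (x ∷_) ih
  ...   | false = ih

  sum-filter : ∀ {a p} {A : Set a} {P : Pred A p} (P? : Decidable P) (f g : A → ℕ) →
               (∀ x → P x → f x ≡ g x) → (∀ x → ¬ P x → g x ≡ 0) →
               ∀ xs → sum (map f (filter P? xs)) ≡ sum (map g xs)
  sum-filter P? f g f≡g vanish []       = refl
  sum-filter P? f g f≡g vanish (x ∷ xs) with ih ← sum-filter P? f g f≡g vanish xs | P? x
  ... | yes P[x] = cong₂ _+_ (f≡g x P[x]) ih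
  ... | no ¬P[x] = trans ih (cong (_+ sum (map g xs)) (sym (vanish x ¬P[x])))

open import Defs
open import Data.Nat using (ℕ; _≤_; _*_; _∸_; _/_; _^_; suc)
open import Data.List using (map; upTo)
open import Data.Nat.ListAction using (sum)
open import Data.Fin using (Fin)
open import Data.Integer using (ℤ)
open import Relation.Binary.PropositionalEquality using (_≡_; _≢_)

open import Data.Nat using (_+_; _<_; _≟_; s≤s)
open import Data.Nat.Properties using (*-cancelˡ-≡; *-distribˡ-∸; *-assoc; m+n∸n≡m; ≤-trans; ≤-reflexive; m∸n≤m)
open import Data.Nat.DivMod using (/-monoˡ-≤; m*n/m*o≡n/o)
open import Data.Nat.Tactic.RingSolver using (solve-∀)
open import Data.Fin.Properties using () renaming (_≟_ to _≟ᶠ_)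
open import Data.List using (filter; length; allFin)
open import Data.List.Properties using (map-cong; filter-≐)
open import Data.Product using (_×_; _,_)
open import Data.Sum using (_⊎_; inj₁; inj₂)
open import Function using (_∘_)
open import Relation.Nullary using (yes; no; ¬_; contradiction)
open import Relation.Nullary.Decidable using (¬?; _×-dec_)
open import Relation.Unary using (Decidable)
open import Relation.Binary.PropositionalEquality using (sym; trans; cong; module ≡-Reasoning)
open Quadruples using (P+8T≡n; P-repeated-row; sum-P²≡n²)
open Counting using (sum-count; sum-map-*ˡ; sum-filter; filter-×-dec)

Outside : ∀ {n} → Fin n → Fin n → Fin n → Fin n → Set
Outside i j k l = l ≢ i × l ≢ j × l ≢ k

outside? : ∀ {n} (i j k : Fin n) → Decidable (Outside i j k)
outside? i j k l = ¬? (l ≟ᶠ i) ×-dec ¬? (l ≟ᶠ j) ×-dec ¬? (l ≟ᶠ k)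

κ-as-fibre : ∀ n H (i j k : Fin n) t →
             κ n H i j k t ≡ length (filter (λ l → T n H i j k l ≟ t) (filter (outside? i j k) (allFin n)))
κ-as-fibre n H i j k t = cong length (trans
  (filter-≐ _ _ ((λ (p , q , r , s) → (p , q , r) , s) , (λ ((p , q , r) , s) → p , q , r , s)) (allFin n))
  (filter-×-dec (outside? i j k) (λ l → T n H i j k l ≟ t) (allFin n)))

T<1+m/2 : ∀ m H (i j k l : Fin (4 * m)) → T (4 * m) H i j k l < suc (m / 2)
T<1+m/2 m H i j k l =
  s≤s (≤-trans (/-monoˡ-≤ 8 (m∸n≤m (4 * m) (P (4 * m) H i j k l))) (≤-reflexive (m*n/m*o≡n/o 4 m 2)))

4x*4x≡16x² : ∀ x → 4 * x * (4 * x) ≡ 16 * x ^ 2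
4x*4x≡16x² = unfolded
  where
  -- the ring solver does not read `x ^ 2`; `x * (x * 1)` is its definitional unfolding
  unfolded : ∀ x → 4 * x * (4 * x) ≡ 16 * (x * (x * 1))
  unfolded = solve-∀

p+8t≡4m⇒p²≡16[m∸2t]² : ∀ m p t → p + 8 * t ≡ 4 * m → p * p ≡ 16 * (m ∸ 2 * t) ^ 2
p+8t≡4m⇒p²≡16[m∸2t]² m p t p+8t≡4m = trans (cong (λ q → q * q) p≡4[m∸2t]) (4x*4x≡16x² (m ∸ 2 * t))
  where
  open ≡-Reasoning
  p≡4[m∸2t] : p ≡ 4 * (m ∸ 2 * t)
  p≡4[m∸2t] = sym (begin
    4 * (m ∸ 2 * t)        ≡⟨ *-distribˡ-∸ 4 m (2 * t) ⟩
    4 * m ∸ 4 * (2 * t)    ≡⟨ cong (4 * m ∸_) (sym (*-assoc 4 2 t)) ⟩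
    4 * m ∸ 8 * t          ≡⟨ cong (_∸ 8 * t) (sym p+8t≡4m) ⟩
    p + 8 * t ∸ 8 * t      ≡⟨ m+n∸n≡m p (8 * t) ⟩
    p                      ∎)

P²-outside : ∀ {m} {H : Fin (4 * m) → Fin (4 * m) → ℤ} → IsHadamard (4 * m) H →
             ∀ {i j k} → i ≢ j → i ≢ k → j ≢ k → ∀ l → Outside i j k l →
             P (4 * m) H i j k l * P (4 * m) H i j k l ≡ 16 * (m ∸ 2 * T (4 * m) H i j k l) ^ 2
P²-outside {m} {H} hd {i} {j} {k} i≢j i≢k j≢k l (l≢i , l≢j , l≢k) =
  p+8t≡4m⇒p²≡16[m∸2t]² m (P (4 * m) H i j k l) (T (4 * m) H i j k l)
    (P+8T≡n hd i≢j i≢k (l≢i ∘ sym) j≢k (l≢j ∘ sym) (l≢k ∘ sym))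

P²-inside : ∀ {n} {H : Fin n → Fin n → ℤ} → IsHadamard n H →
            ∀ {i j k} → i ≢ j → i ≢ k → j ≢ k → ∀ l → ¬ Outside i j k l →
            P n H i j k l * P n H i j k l ≡ 0
P²-inside hd {i} {j} {k} i≢j i≢k j≢k l ¬outside =
  cong (λ p → p * p) (P-repeated-row hd i≢j i≢k j≢k repeated)
  where
  repeated : l ≡ i ⊎ l ≡ j ⊎ l ≡ k
  repeated with l ≟ᶠ i | l ≟ᶠ j | l ≟ᶠ k
  ... | yes l≡i | _       | _       = inj₁ l≡i
  ... | no _    | yes l≡j | _       = inj₂ (inj₁ l≡j)
  ... | no _    | no _    | yes l≡k = inj₂ (inj₂ l≡k)
  ... | no l≢i  | no l≢j  | no l≢k  = contradiction (l≢i , l≢j , l≢k) ¬outside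

lemma2p1 : (m : ℕ) → 1 ≤ m → (H : Fin (4 * m) → Fin (4 * m) → ℤ) → IsHadamard (4 * m) H →
    (i j k : Fin (4 * m)) → i ≢ j → i ≢ k → j ≢ k →
    sum (map (λ t → κ (4 * m) H i j k t * (m ∸ 2 * t) ^ 2) (upTo (suc (m / 2)))) ≡ m ^ 2
lemma2p1 m _ H hd i j k i≢j i≢k j≢k = *-cancelˡ-≡ _ _ 16 (begin
  16 * sum (map (λ t → κ n H i j k t * w t) (upTo (suc (m / 2))))
    ≡⟨ cong (16 *_) grouped-by-type ⟩
  16 * sum (map (w ∘ τ) outside)
    ≡⟨ sym (sum-map-*ˡ 16 (w ∘ τ) outside) ⟩
  sum (map (λ l → 16 * w (τ l)) outside)
    ≡⟨ sum-filter (outside? i j k) (λ l → 16 * w (τ l)) P²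
                  (λ l → sym ∘ P²-outside {m} hd i≢j i≢k j≢k l) (P²-inside hd i≢j i≢k j≢k) (allFin n) ⟩
  sum (map P² (allFin n))
    ≡⟨ sum-P²≡n² hd i j k ⟩
  n * n
    ≡⟨ 4x*4x≡16x² m ⟩
  16 * m ^ 2 ∎)
  where
  open ≡-Reasoning
  n = 4 * m
  τ = T n H i j k
  w : ℕ → ℕ
  w t = (m ∸ 2 * t) ^ 2
  outside = filter (outside? i j k) (allFin n)
  P² : Fin n → ℕ
  P² l = P n H i j k l * P n H i j k l
  grouped-by-type : sum (map (λ t → κ n H i j k t * w t) (upTo (suc (m / 2)))) ≡ sum (map (w ∘ τ) outside)
  grouped-by-type = trans
    (cong sum (map-cong (λ t → cong (_* w t) (κ-as-fibre n H i j k t)) (upTo (suc (m / 2)))))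
    (sum-count τ w (T<1+m/2 m H i j k) outside)
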